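{- Let $A$ be an $r\times n$ integer matrix with columns $C_1,\dots,C_n$ and first-row entries $a_{11}>0$, $a_{12}<0$. Let $A_1=(C_1,C_1+C_2,C_3,\dots,C_n)$, $A_2=(C_1+C_2,C_2,C_3,\dots,C_n)$, $A_3=(C_1+C_2,C_3,\dots,C_n)$. Let $\bar E$ (resp. $\bar E_i$) be the set of vectors with all entries positive integers solving $A\alpha=\mathbf{0}$ (resp. $A_i\alpha=\mathbf{0}$). Suppose $\bar E$ is nonempty. If any two of $\bar E_1,\bar E_2,\bar E_3$ are nonempty, then all three are nonempty. -}

module Defs where

open import Data.Nat using (ℕ; zero; suc)
open import Data.Fin using (Fin; zero; suc)
open import Data.Integer using (ℤ; _+_; _*_; _<_; 0ℤ; +_)
open import Data.Product using (_×_; ∃)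
open import Relation.Binary.PropositionalEquality using (_≡_)

Matrix : ℕ → ℕ → Set
Matrix r k = Fin r → Fin k → ℤ

∑ : {k : ℕ} → (Fin k → ℤ) → ℤ
∑ {zero}  f = 0ℤ
∑ {suc k} f = f zero + ∑ (λ j → f (suc j))

mulVec : {r k : ℕ} → Matrix r k → (Fin k → ℤ) → Fin r → ℤ
mulVec M α i = ∑ (λ j → M i j * α j)

InEbar : {r k : ℕ} → Matrix r k → (Fin k → ℤ) → Set
InEbar M α = (∀ j → + 0 < α j) × (∀ i → mulVec M α i ≡ 0ℤ)

EbarNonempty : {r k : ℕ} → Matrix r k → Set
EbarNonempty M = ∃ λ α → InEbar M α

-- Column operations; columns C₁ = column zero, C₂ = column (suc zero).
-- A₁ = (C₁, C₁+C₂, C₃, …, Cₙ)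
A₁ : {r m : ℕ} → Matrix r (suc (suc m)) → Matrix r (suc (suc m))
A₁ A i zero             = A i zero
A₁ A i (suc zero)       = A i zero + A i (suc zero)
A₁ A i (suc (suc j))    = A i (suc (suc j))

A₂ : {r m : ℕ} → Matrix r (suc (suc m)) → Matrix r (suc (suc m))
A₂ A i zero             = A i zero + A i (suc zero)
A₂ A i (suc zero)       = A i (suc zero)
A₂ A i (suc (suc j))    = A i (suc (suc j))

A₃ : {r m : ℕ} → Matrix r (suc (suc m)) → Matrix r (suc m)
A₃ A i zero             = A i zero + A i (suc zero)
A₃ A i (suc j)          = A i (suc (suc j))

{-# OPTIONS --safe #-}
module Submission where

open import Defs
open import Data.Nat using (ℕ; suc)
open import Data.Fin using (Fin; zero; suc)
open import Data.Integer
  using (ℤ; _+_; _*_; _-_; -_; _<_; _>_; _≤_; +_; 0ℤ; 1ℤ; -1ℤ; positive; nonNegative)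
open import Data.Integer.Properties
open import Data.Integer.Tactic.RingSolver using (solve-∀)
open import Data.Product using (_×_; _,_; ∃)
open import Data.Sum using (_⊎_; inj₁; inj₂)
open import Data.Vec.Functional using (_∷_; tail)
open import Function.Bundles using (_⇔_; mk⇔; Equivalence)
open import Relation.Binary.PropositionalEquality
  using (_≡_; refl; sym; trans; cong; cong₂; subst; module ≡-Reasoning)

-- Via the column operations, a solution in Ē(A₁), Ē(A₂) or Ē(A₃) is the same
-- thing as a solution β ∈ Ē(A) with β₁ > β₂, β₁ < β₂ or β₁ = β₂ respectively;
-- e.g. A₁ α = A (α₁ + α₂, α₂, α₃, …).  Positive combinations of solutions are
-- solutions, so a solution with β₁ > β₂ and one with γ₁ < γ₂ combine to one
-- with equal first coordinates.  Conversely, if δ ∈ Ē(A) has δ₁ = δ₂ and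
-- β ∈ Ē(A), then p δ - β ∈ Ē(A) for large p, and it orders its first two
-- coordinates the opposite way to β.

private
  variable
    r k m : ℕ

i<j⇒0<j-i : ∀ {i j} → i < j → + 0 < j - i
i<j⇒0<j-i {i} {j} i<j = subst (_< j - i) (+-inverseʳ i) (+-monoˡ-< (- i) i<j)

i<j+i : ∀ {i j} → + 0 < j → i < j + i
i<j+i {i} {j} j>0 = subst (_< j + i) (+-identityˡ i) (+-monoˡ-< i j>0)

0<i∧0<j⇒0<i*j : ∀ {i j} → + 0 < i → + 0 < j → + 0 < i * j
0<i∧0<j⇒0<i*j {i} {j} i>0 j>0 =
  subst (_< i * j) (*-zeroʳ i) (*-monoˡ-<-pos i {{positive i>0}} j>0)

[i-j]+j≡i : ∀ i j → i - j + j ≡ i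
[i-j]+j≡i = solve-∀

∑-nonNeg : {f : Fin k → ℤ} → (∀ j → + 0 ≤ f j) → + 0 ≤ ∑ f
∑-nonNeg {k = 0}     _   = ≤-refl
∑-nonNeg {k = suc k} f≥0 = +-mono-≤ (f≥0 zero) (∑-nonNeg (λ j → f≥0 (suc j)))

≤-∑ : {f : Fin k → ℤ} → (∀ j → + 0 ≤ f j) → ∀ j → f j ≤ ∑ f
≤-∑ {f = f} f≥0 zero =
  i≤i+j (f zero) (∑ (λ j → f (suc j))) {{nonNegative (∑-nonNeg (λ j → f≥0 (suc j)))}}
≤-∑ {f = f} f≥0 (suc j) =
  ≤-trans (≤-∑ (λ j → f≥0 (suc j)) j)
          (i≤j+i (∑ (λ j → f (suc j))) (f zero) {{nonNegative (f≥0 zero)}})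

multiple-dominates : {δ β : Fin k → ℤ} → (∀ j → + 0 < δ j) → (∀ j → + 0 ≤ β j) →
                     ∃ λ p → ∀ j → β j < p * δ j
multiple-dominates {δ = δ} {β} δ>0 β≥0 = p , β<pδ
  where
  open ≤-Reasoning
  p : ℤ
  p = 1ℤ + ∑ β
  ∑β<p : ∑ β < p
  ∑β<p = suc[i]≤j⇒i<j ≤-refl
  β<pδ : ∀ j → β j < p * δ j
  β<pδ j = begin-strict
    β j      ≤⟨ ≤-∑ β≥0 j ⟩
    ∑ β      <⟨ ∑β<p ⟩
    p        ≡⟨ *-identityʳ p ⟨
    p * 1ℤ   ≤⟨ *-monoˡ-≤-nonNeg p {{nonNegative (<⇒≤ (≤-<-trans (∑-nonNeg β≥0) ∑β<p))}}
                                   (i<j⇒suc[i]≤j (δ>0 j)) ⟩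
    p * δ j  ∎

lincomb : ℤ → (Fin k → ℤ) → ℤ → (Fin k → ℤ) → Fin k → ℤ
lincomb p β q γ j = p * β j + q * γ j

mulVec-lincomb : ∀ (M : Matrix r k) p β q γ i →
                 mulVec M (lincomb p β q γ) i ≡ p * mulVec M β i + q * mulVec M γ i
mulVec-lincomb {k = 0}     M p β q γ i = sym (cong₂ _+_ (*-zeroʳ p) (*-zeroʳ q))
mulVec-lincomb {k = suc k} M p β q γ i =
  trans (cong (_+_ (M i zero * lincomb p β q γ zero))
              (mulVec-lincomb (λ i j → M i (suc j)) p (tail β) q (tail γ) i))
        (interchange (M i zero) p (β zero) q (γ zero) _ _)
  where
  interchange : ∀ a p x q y S T →
                a * (p * x + q * y) + (p * S + q * T) ≡ p * (a * x + S) + q * (a * y + T)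
  interchange = solve-∀

InEbar-lincomb : {M : Matrix r k} {β γ : Fin k → ℤ} {p q : ℤ} → InEbar M β → InEbar M γ →
                 (∀ j → + 0 < lincomb p β q γ j) → InEbar M (lincomb p β q γ)
InEbar-lincomb {M = M} {β} {γ} {p} {q} (_ , Mβ≡0) (_ , Mγ≡0) combination>0 =
  combination>0 , λ i → begin
  mulVec M (lincomb p β q γ) i        ≡⟨ mulVec-lincomb M p β q γ i ⟩
  p * mulVec M β i + q * mulVec M γ i ≡⟨ cong₂ (λ u v → p * u + q * v) (Mβ≡0 i) (Mγ≡0 i) ⟩
  p * 0ℤ + q * 0ℤ                     ≡⟨ cong₂ _+_ (*-zeroʳ p) (*-zeroʳ q) ⟩
  0ℤ                                  ∎
  where open ≡-Reasoning

InEbar-reflect : {M : Matrix r k} {δ β : Fin k → ℤ} → InEbar M δ → InEbar M β →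
                 ∃ λ p → InEbar M (lincomb p δ -1ℤ β)
InEbar-reflect {M = M} {δ} {β} δ∈Ē@(δ>0 , _) β∈Ē@(β>0 , _)
  with multiple-dominates δ>0 (λ j → <⇒≤ (β>0 j))
... | p , β<pδ = p , InEbar-lincomb {M = M} {p = p} {q = -1ℤ} δ∈Ē β∈Ē pδ-β>0
  where
  pδ-β>0 : ∀ j → + 0 < lincomb p δ -1ℤ β j
  pδ-β>0 j = subst (λ x → + 0 < p * δ j + x) (sym (-1*i≡-i (β j))) (i<j⇒0<j-i (β<pδ j))

lincomb-reflect-< : ∀ p (δ β : Fin k → ℤ) {i j} → δ i ≡ δ j → β i < β j →
                    lincomb p δ -1ℤ β j < lincomb p δ -1ℤ β i
lincomb-reflect-< p δ β {i} {j} δi≡δj βi<βj =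
  subst (λ x → p * x + -1ℤ * β j < p * δ i + -1ℤ * β i) δi≡δj
        (+-monoʳ-< (p * δ i) (*-monoˡ-<-neg -1ℤ βi<βj))

positive-∷ : ∀ {x} {v : Fin k → ℤ} → + 0 < x → (∀ j → + 0 < v j) → ∀ j → + 0 < (x ∷ v) j
positive-∷ x>0 _   zero    = x>0
positive-∷ _   v>0 (suc j) = v>0 j

EbarWith : Matrix r (suc (suc m)) → (ℤ → ℤ → Set) → Set
EbarWith A _∼_ = ∃ λ β → InEbar A β × (β zero ∼ β (suc zero))

module _ (A : Matrix r (suc (suc m))) where

  mulVec-A₁ : ∀ α i → mulVec (A₁ A) α i ≡ mulVec A (α zero + α (suc zero) ∷ tail α) i
  mulVec-A₁ α i = shear (A i zero) (A i (suc zero)) (α zero) (α (suc zero)) _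
    where
    shear : ∀ a b x y R → a * x + ((a + b) * y + R) ≡ a * (x + y) + (b * y + R)
    shear = solve-∀

  mulVec-A₂ : ∀ α i →
              mulVec (A₂ A) α i ≡ mulVec A (α zero ∷ α (suc zero) + α zero ∷ tail (tail α)) i
  mulVec-A₂ α i = shear (A i zero) (A i (suc zero)) (α zero) (α (suc zero)) _
    where
    shear : ∀ a b x y R → (a + b) * x + (b * y + R) ≡ a * x + (b * (y + x) + R)
    shear = solve-∀

  mulVec-A₃ : ∀ α i → mulVec (A₃ A) α i ≡ mulVec A (α zero ∷ α zero ∷ tail α) i
  mulVec-A₃ α i = distrib (A i zero) (A i (suc zero)) (α zero) _
    where
    distrib : ∀ a b x R → (a + b) * x + R ≡ a * x + (b * x + R)
    distrib = solve-∀

  open ≡-Reasoning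

  EbarNonempty-A₁⇔ : EbarNonempty (A₁ A) ⇔ EbarWith A _>_
  EbarNonempty-A₁⇔ = mk⇔ to from
    where
    to : EbarNonempty (A₁ A) → EbarWith A _>_
    to (α , α>0 , A₁α≡0) =
      (α zero + α (suc zero) ∷ tail α)
      , (positive-∷ (+-mono-< (α>0 zero) (α>0 (suc zero))) (λ j → α>0 (suc j))
        , λ i → trans (sym (mulVec-A₁ α i)) (A₁α≡0 i))
      , i<j+i (α>0 zero)
    from : EbarWith A _>_ → EbarNonempty (A₁ A)
    from (β , (β>0 , Aβ≡0) , β₂<β₁) = α , positive-∷ (i<j⇒0<j-i β₂<β₁) (λ j → β>0 (suc j)) , A₁α≡0
      where
      α : Fin (suc (suc m)) → ℤ
      α = β zero - β (suc zero) ∷ tail β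
      A₁α≡0 : ∀ i → mulVec (A₁ A) α i ≡ 0ℤ
      A₁α≡0 i = begin
        mulVec (A₁ A) α i                               ≡⟨ mulVec-A₁ α i ⟩
        mulVec A (β zero - β (suc zero) + β (suc zero) ∷ tail β) i
          ≡⟨ cong (λ x → mulVec A (x ∷ tail β) i) ([i-j]+j≡i (β zero) (β (suc zero))) ⟩
        mulVec A β i                                    ≡⟨ Aβ≡0 i ⟩
        0ℤ                                              ∎

  EbarNonempty-A₂⇔ : EbarNonempty (A₂ A) ⇔ EbarWith A _<_
  EbarNonempty-A₂⇔ = mk⇔ to from
    where
    to : EbarNonempty (A₂ A) → EbarWith A _<_
    to (α , α>0 , A₂α≡0) =
      (α zero ∷ α (suc zero) + α zero ∷ tail (tail α))
      , (positive-∷ (α>0 zero)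
          (positive-∷ (+-mono-< (α>0 (suc zero)) (α>0 zero)) (λ j → α>0 (suc (suc j))))
        , λ i → trans (sym (mulVec-A₂ α i)) (A₂α≡0 i))
      , i<j+i (α>0 (suc zero))
    from : EbarWith A _<_ → EbarNonempty (A₂ A)
    from (β , (β>0 , Aβ≡0) , β₁<β₂) =
      α , positive-∷ (β>0 zero) (positive-∷ (i<j⇒0<j-i β₁<β₂) (λ j → β>0 (suc (suc j)))) , A₂α≡0
      where
      α : Fin (suc (suc m)) → ℤ
      α = β zero ∷ β (suc zero) - β zero ∷ tail (tail β)
      A₂α≡0 : ∀ i → mulVec (A₂ A) α i ≡ 0ℤ
      A₂α≡0 i = begin
        mulVec (A₂ A) α i                                    ≡⟨ mulVec-A₂ α i ⟩
        mulVec A (β zero ∷ β (suc zero) - β zero + β zero ∷ tail (tail β)) i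
          ≡⟨ cong (λ x → mulVec A (β zero ∷ x ∷ tail (tail β)) i)
                  ([i-j]+j≡i (β (suc zero)) (β zero)) ⟩
        mulVec A β i                                         ≡⟨ Aβ≡0 i ⟩
        0ℤ                                                   ∎

  EbarNonempty-A₃⇔ : EbarNonempty (A₃ A) ⇔ EbarWith A _≡_
  EbarNonempty-A₃⇔ = mk⇔ to from
    where
    to : EbarNonempty (A₃ A) → EbarWith A _≡_
    to (α , α>0 , A₃α≡0) =
      (α zero ∷ α zero ∷ tail α)
      , (positive-∷ (α>0 zero) (positive-∷ (α>0 zero) (λ j → α>0 (suc j)))
        , λ i → trans (sym (mulVec-A₃ α i)) (A₃α≡0 i))
      , refl
    from : EbarWith A _≡_ → EbarNonempty (A₃ A)
    from (β , (β>0 , Aβ≡0) , β₁≡β₂) = α , positive-∷ (β>0 zero) (λ j → β>0 (suc (suc j))) , A₃α≡0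
      where
      α : Fin (suc m) → ℤ
      α = β zero ∷ tail (tail β)
      A₃α≡0 : ∀ i → mulVec (A₃ A) α i ≡ 0ℤ
      A₃α≡0 i = begin
        mulVec (A₃ A) α i                                ≡⟨ mulVec-A₃ α i ⟩
        mulVec A (β zero ∷ β zero ∷ tail (tail β)) i
          ≡⟨ cong (λ x → mulVec A (β zero ∷ x ∷ tail (tail β)) i) β₁≡β₂ ⟩
        mulVec A β i                                     ≡⟨ Aβ≡0 i ⟩
        0ℤ                                               ∎

  EbarWith>∧<⇒≡ : EbarWith A _>_ → EbarWith A _<_ → EbarWith A _≡_
  EbarWith>∧<⇒≡ (β , β∈Ē@(β>0 , _) , β₂<β₁) (γ , γ∈Ē@(γ>0 , _) , γ₁<γ₂) =
    lincomb p β q γ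
    , InEbar-lincomb {M = A} {p = p} {q = q} β∈Ē γ∈Ē
        (λ j → +-mono-< (0<i∧0<j⇒0<i*j p>0 (β>0 j)) (0<i∧0<j⇒0<i*j q>0 (γ>0 j)))
    , balanced (β zero) (β (suc zero)) (γ zero) (γ (suc zero))
    where
    p q : ℤ
    p = γ (suc zero) - γ zero
    q = β zero - β (suc zero)
    p>0 : + 0 < p
    p>0 = i<j⇒0<j-i γ₁<γ₂
    q>0 : + 0 < q
    q>0 = i<j⇒0<j-i β₂<β₁
    balanced : ∀ β₁ β₂ γ₁ γ₂ →
               (γ₂ - γ₁) * β₁ + (β₁ - β₂) * γ₁ ≡ (γ₂ - γ₁) * β₂ + (β₁ - β₂) * γ₂
    balanced = solve-∀

  EbarWith≡∧<⇒> : EbarWith A _≡_ → EbarWith A _<_ → EbarWith A _>_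
  EbarWith≡∧<⇒> (δ , δ∈Ē , δ₁≡δ₂) (β , β∈Ē , β₁<β₂) with InEbar-reflect {M = A} δ∈Ē β∈Ē
  ... | p , γ∈Ē = lincomb p δ -1ℤ β , γ∈Ē , lincomb-reflect-< p δ β δ₁≡δ₂ β₁<β₂

  EbarWith≡∧>⇒< : EbarWith A _≡_ → EbarWith A _>_ → EbarWith A _<_
  EbarWith≡∧>⇒< (δ , δ∈Ē , δ₁≡δ₂) (β , β∈Ē , β₂<β₁) with InEbar-reflect {M = A} δ∈Ē β∈Ē
  ... | p , γ∈Ē = lincomb p δ -1ℤ β , γ∈Ē , lincomb-reflect-< p δ β (sym δ₁≡δ₂) β₂<β₁

  open Equivalence

  EbarNonempty-A₁∧A₂⇒A₃ : EbarNonempty (A₁ A) → EbarNonempty (A₂ A) → EbarNonempty (A₃ A)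
  EbarNonempty-A₁∧A₂⇒A₃ E₁ E₂ =
    from EbarNonempty-A₃⇔ (EbarWith>∧<⇒≡ (to EbarNonempty-A₁⇔ E₁) (to EbarNonempty-A₂⇔ E₂))

  EbarNonempty-A₁∧A₃⇒A₂ : EbarNonempty (A₁ A) → EbarNonempty (A₃ A) → EbarNonempty (A₂ A)
  EbarNonempty-A₁∧A₃⇒A₂ E₁ E₃ =
    from EbarNonempty-A₂⇔ (EbarWith≡∧>⇒< (to EbarNonempty-A₃⇔ E₃) (to EbarNonempty-A₁⇔ E₁))

  EbarNonempty-A₂∧A₃⇒A₁ : EbarNonempty (A₂ A) → EbarNonempty (A₃ A) → EbarNonempty (A₁ A)
  EbarNonempty-A₂∧A₃⇒A₁ E₂ E₃ =
    from EbarNonempty-A₁⇔ (EbarWith≡∧<⇒> (to EbarNonempty-A₃⇔ E₃) (to EbarNonempty-A₂⇔ E₂))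

lemma6p1 : (r m : ℕ) (A : Matrix (suc r) (suc (suc m)))
    → + 0 < A zero zero
    → A zero (suc zero) < + 0
    → EbarNonempty A
    → (EbarNonempty (A₁ A) × EbarNonempty (A₂ A))
      ⊎ (EbarNonempty (A₁ A) × EbarNonempty (A₃ A))
      ⊎ (EbarNonempty (A₂ A) × EbarNonempty (A₃ A))
    → EbarNonempty (A₁ A) × EbarNonempty (A₂ A) × EbarNonempty (A₃ A)
lemma6p1 r m A _ _ _ (inj₁ (E₁ , E₂))        = E₁ , E₂ , EbarNonempty-A₁∧A₂⇒A₃ A E₁ E₂
lemma6p1 r m A _ _ _ (inj₂ (inj₁ (E₁ , E₃))) = E₁ , EbarNonempty-A₁∧A₃⇒A₂ A E₁ E₃ , E₃
lemma6p1 r m A _ _ _ (inj₂ (inj₂ (E₂ , E₃))) = EbarNonempty-A₂∧A₃⇒A₁ A E₂ E₃ , E₂ , E₃
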